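{- There exist infinitely many pairs of primes $(p,q)$ such that $p$ is not a primitive root modulo $q$ and $q$ is a primitive root modulo $p^2$.
   Context: An integer $g$ is a primitive root modulo $m$ if it generates the multiplicative group $(\mathbb{Z}/m\mathbb{Z})^\times$. -}

module Defs where

open import Data.Nat using (ℕ; _+_; _*_; _^_)
open import Data.Nat.Coprimality using (Coprime)
open import Data.Product using (∃; _×_)
open import Data.Sum using (_⊎_)
open import Relation.Binary.PropositionalEquality using (_≡_)

infix 4 _≡_[mod_]
_≡_[mod_] : ℕ → ℕ → ℕ → Set
a ≡ b [mod m ] = ∃ λ k → (a + k * m ≡ b) ⊎ (b + k * m ≡ a)

IsPrimitiveRoot : ℕ → ℕ → Set
IsPrimitiveRoot g m =
  Coprime g m × ((a : ℕ) → Coprime a m → ∃ λ k → (g ^ k ≡ a [mod m ]))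

-- Take p = 2.  For L = N! the number M = 2 ^ (2L + 1) − 1 is ≡ 3 (mod 4), so it has a prime
-- factor q ≡ 3 (mod 4), and q is then a primitive root modulo 4.  Since 2 has odd order modulo q,
-- −1 is not a power of 2 modulo q, so 2 is not a primitive root modulo q.  Finally q > N: the
-- order d ≤ q of 2 modulo q divides N! whenever q ≤ N, which would force 2 ≡ 2 ^ (2L + 1) ≡ 1 (mod q).
module Submission where

open import Defs
open import Data.Nat using (ℕ; zero; suc; _+_; _*_; _∸_; _^_; _%_; _/_; _!; _≤_; _<_; s≤s; NonZero)
open import Data.Nat.Properties
open import Data.Nat.Divisibility
open import Data.Nat.DivMod
open import Data.Nat.Coprimality using (Coprime)
open import Data.Nat.Primality using (Prime; euclidsLemma; ¬prime[1]; prime[2]; prime⇒nonZero)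
open import Data.Nat.Primality.Factorisation using (factorise; PrimeFactorisation)
open PrimeFactorisation using (factors; isFactorisation; factorsPrime)
open import Data.Nat.ListAction using (product)
open import Data.Nat.ListAction.Properties using (∈⇒∣product)
open import Data.Nat.Tactic.RingSolver using (solve-∀)
open import Data.List using (_∷_)
import Data.List.Relation.Unary.All as All
open import Data.List.Relation.Unary.Any using (Any; here; there)
open import Data.List.Membership.Propositional using (_∈_; find)
open import Data.Fin as Fin using (Fin; toℕ; fromℕ<)
open import Data.Fin.Properties using (pigeonhole; toℕ-fromℕ<; toℕ≤pred[n])
open import Data.Product using (∃; ∃₂; _×_; _,_; proj₁; proj₂)
open import Data.Sum using (_⊎_; inj₁; inj₂)
open import Data.Empty using (⊥-elim)
open import Relation.Nullary using (¬_)
open import Relation.Binary.PropositionalEquality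
open ≡-Reasoning

infix 4 _≡1[mod_]
_≡1[mod_] : ℕ → ℕ → Set
x ≡1[mod q ] = ∃ λ c → x ≡ 1 + c * q

≡1[mod]-* : ∀ {q x y} → x ≡1[mod q ] → y ≡1[mod q ] → x * y ≡1[mod q ]
≡1[mod]-* {q} (a , refl) (b , refl) = a + b + a * q * b , expand a b q
  where
  expand : ∀ a b q → (1 + a * q) * (1 + b * q) ≡ 1 + (a + b + a * q * b) * q
  expand = solve-∀

≡1[mod]-^ : ∀ {q x} → x ≡1[mod q ] → ∀ m → x ^ m ≡1[mod q ]
≡1[mod]-^ _  zero    = 0 , refl
≡1[mod]-^ x≡1 (suc m) = ≡1[mod]-* x≡1 (≡1[mod]-^ x≡1 m)

^-≡1[mod]-∣ : ∀ {q a d m} → a ^ d ≡1[mod q ] → d ∣ m → a ^ m ≡1[mod q ]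
^-≡1[mod]-∣ {q} {a} {d} ad≡1 (divides k refl) =
  subst (_≡1[mod q ]) (trans (^-*-assoc a d k) (cong (a ^_) (*-comm d k))) (≡1[mod]-^ ad≡1 k)

≡1[mod]-*ˡ⇒∣ : ∀ {q x} k → x ≡1[mod q ] → suc k * x ≡1[mod q ] → q ∣ k
≡1[mod]-*ˡ⇒∣ {q} k (b , refl) (c , kx≡) =
  ∣m+n∣m⇒∣n (divides c (suc-injective (trans (sym (expand k b q)) kx≡))) (n∣m*n (suc k * b))
  where
  expand : ∀ k b q → suc k * (1 + b * q) ≡ suc (suc k * b * q + k)
  expand = solve-∀

∣+-resp-≡[mod] : ∀ {m a b c} → a ≡ b [mod m ] → m ∣ b + c → m ∣ a + c
∣+-resp-≡[mod] {m} {a} {b} {c} (k , inj₁ a+km≡b) m∣b+c = ∣m+n∣m⇒∣n (subst (m ∣_) b+c≡ m∣b+c) (n∣m*n k)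
  where
  b+c≡ : b + c ≡ k * m + (a + c)
  b+c≡ = begin
    b + c           ≡⟨ cong (_+ c) a+km≡b ⟨
    a + k * m + c   ≡⟨ cong (_+ c) (+-comm a (k * m)) ⟩
    k * m + a + c   ≡⟨ +-assoc (k * m) a c ⟩
    k * m + (a + c) ∎
∣+-resp-≡[mod] {m} {a} {b} {c} (k , inj₂ b+km≡a) m∣b+c = subst (m ∣_) a+c≡ (∣m∣n⇒∣m+n m∣b+c (n∣m*n k))
  where
  a+c≡ : b + c + k * m ≡ a + c
  a+c≡ = begin
    b + c + k * m   ≡⟨ +-assoc b c _ ⟩
    b + (c + k * m) ≡⟨ cong (b +_) (+-comm c (k * m)) ⟩
    b + (k * m + c) ≡⟨ +-assoc b _ c ⟨
    b + k * m + c   ≡⟨ cong (_+ c) b+km≡a ⟩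
    a + c           ∎

≡+[mod]⇒∣ : ∀ {q x z} → x ≡ x + z [mod q ] → q ∣ z
≡+[mod]⇒∣ {q} {x} {z} (k , inj₁ x+kq≡x+z) = divides k (sym (+-cancelˡ-≡ x _ _ x+kq≡x+z))
≡+[mod]⇒∣ {q} {x} {z} (k , inj₂ x+z+kq≡x) =
  subst (q ∣_) (sym (m+n≡0⇒m≡0 z (+-cancelˡ-≡ x _ 0 x+[z+kq]≡x+0))) (q ∣0)
  where
  x+[z+kq]≡x+0 : x + (z + k * q) ≡ x + 0
  x+[z+kq]≡x+0 = trans (sym (+-assoc x z _)) (trans x+z+kq≡x (sym (+-identityʳ x)))

+-*-∸≡ : ∀ r n {x y} → x ≤ y → r + x * n + (y ∸ x) * n ≡ r + y * n
+-*-∸≡ r n {x} {y} x≤y = begin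
  r + x * n + (y ∸ x) * n   ≡⟨ +-assoc r _ _ ⟩
  r + (x * n + (y ∸ x) * n) ≡⟨ cong (r +_) (*-distribʳ-+ n x (y ∸ x)) ⟨
  r + (x + (y ∸ x)) * n     ≡⟨ cong (λ t → r + t * n) (m+[n∸m]≡n x≤y) ⟩
  r + y * n                 ∎

+-*-≡[mod] : ∀ r x y n → r + x * n ≡ r + y * n [mod n ]
+-*-≡[mod] r x y n with ≤-total x y
... | inj₁ x≤y = y ∸ x , inj₁ (+-*-∸≡ r n x≤y)
... | inj₂ y≤x = x ∸ y , inj₂ (+-*-∸≡ r n y≤x)

%≡%⇒≡[mod] : ∀ a b n .{{_ : NonZero n}} → a % n ≡ b % n → a ≡ b [mod n ]
%≡%⇒≡[mod] a b n a%n≡b%n = subst₂ (_≡_[mod n ]) (sym (m≡m%n+[m/n]*n a n)) (sym b≡) (+-*-≡[mod] (a % n) (a / n) (b / n) n)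
  where
  b≡ : b ≡ a % n + (b / n) * n
  b≡ = trans (m≡m%n+[m/n]*n b n) (cong (_+ (b / n) * n) (sym a%n≡b%n))

prime∣^⇒∣ : ∀ {p m} → Prime p → ∀ k → p ∣ m ^ k → p ∣ m
prime∣^⇒∣ p-prime zero    p∣1 = ⊥-elim (¬prime[1] (subst Prime (∣1⇒≡1 p∣1) p-prime))
prime∣^⇒∣ {m = m} p-prime (suc k) p∣m*m^k with euclidsLemma m (m ^ k) p-prime p∣m*m^k
... | inj₁ p∣m   = p∣m
... | inj₂ p∣m^k = prime∣^⇒∣ p-prime k p∣m^k

^-cancel-≡1[mod] : ∀ {q a} i d → Prime q → ¬ q ∣ a → a ^ i ≡ a ^ (i + d) [mod q ] → a ^ d ≡1[mod q ]
^-cancel-≡1[mod] {q} {a} i d q-prime q∤a same with a ^ d in a^d≡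
... | zero  = ⊥-elim (q∤a (subst (q ∣_) (sym (m^n≡0⇒m≡0 a d a^d≡)) (q ∣0)))
... | suc y with euclidsLemma (a ^ i) y q-prime (≡+[mod]⇒∣ (subst (a ^ i ≡_[mod q ]) a^[i+d]≡ same))
  where
  a^[i+d]≡ : a ^ (i + d) ≡ a ^ i + a ^ i * y
  a^[i+d]≡ = begin
    a ^ (i + d)       ≡⟨ ^-distribˡ-+-* a i d ⟩
    a ^ i * a ^ d     ≡⟨ cong (a ^ i *_) a^d≡ ⟩
    a ^ i * suc y     ≡⟨ *-suc (a ^ i) y ⟩
    a ^ i + a ^ i * y ∎
... | inj₁ q∣a^i = ⊥-elim (q∤a (prime∣^⇒∣ q-prime i q∣a^i))
... | inj₂ (divides c y≡cq) = c , cong suc y≡cq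

order-bounded : ∀ {q a} → Prime q → ¬ q ∣ a → ∃ λ d → 0 < d × d ≤ q × a ^ d ≡1[mod q ]
order-bounded {q} {a} q-prime q∤a = fromCollision (pigeonhole (n<1+n q) residue)
  where
  instance _ = prime⇒nonZero q-prime
  residue : Fin (suc q) → Fin q
  residue i = fromℕ< (m%n<n (a ^ toℕ i) q)
  fromCollision : ∃₂ (λ i j → i Fin.< j × residue i ≡ residue j) → ∃ λ d → 0 < d × d ≤ q × a ^ d ≡1[mod q ]
  fromCollision (i , j , i<j , same) =
    toℕ j ∸ toℕ i , m<n⇒0<n∸m i<j , ≤-trans (m∸n≤m (toℕ j) (toℕ i)) (toℕ≤pred[n] j) ,
    ^-cancel-≡1[mod] (toℕ i) _ q-prime q∤a (%≡%⇒≡[mod] _ _ q a^i%q≡a^[i+d]%q)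
    where
    a^i%q≡a^[i+d]%q : a ^ toℕ i % q ≡ a ^ (toℕ i + (toℕ j ∸ toℕ i)) % q
    a^i%q≡a^[i+d]%q = begin
      a ^ toℕ i % q                       ≡⟨ toℕ-fromℕ< _ ⟨
      toℕ (residue i)                     ≡⟨ cong toℕ same ⟩
      toℕ (residue j)                     ≡⟨ toℕ-fromℕ< _ ⟩
      a ^ toℕ j % q                       ≡⟨ cong (λ e → a ^ e % q) (m+[n∸m]≡n (<⇒≤ i<j)) ⟨
      a ^ (toℕ i + (toℕ j ∸ toℕ i)) % q   ∎

-- A weak form of Fermat's little theorem: the order of a is at most q, hence divides N!.
^-factorial-≡1[mod] : ∀ {q a N m} → Prime q → ¬ q ∣ a → q ≤ N → N ! ∣ m → a ^ m ≡1[mod q ]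
^-factorial-≡1[mod] q-prime q∤a q≤N N!∣m with order-bounded q-prime q∤a
... | suc d , _ , d<q , a^d≡1 =
  ^-≡1[mod]-∣ a^d≡1 (∣-trans (m∣m*n {suc d} (d !)) (∣-trans (m≤n⇒m!∣n! (≤-trans d<q q≤N)) N!∣m))

∣x+1⇒∣x^odd+1 : ∀ {d x} → d ∣ x + 1 → ∀ k → d ∣ x ^ suc (k * 2) + 1
∣x+1⇒∣x^odd+1 {d} {x} d∣x+1 zero = subst (λ t → d ∣ t + 1) (sym (*-identityʳ x)) d∣x+1
∣x+1⇒∣x^odd+1 {d} {x} d∣x+1 (suc k) =
  ∣m+n∣m⇒∣n (subst (d ∣_) (expand x (x ^ suc (k * 2))) (∣m∣n⇒∣m+n (∣m⇒∣m*n _ d∣x+1) (∣x+1⇒∣x^odd+1 d∣x+1 k)))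
            (∣m⇒∣m*n (x ^ suc (k * 2)) d∣x+1)
  where
  -- x ^ (m + 2) + 1 = (x + 1) (x ^ (m + 1) − x ^ m) + (x ^ m + 1), with the subtraction moved across.
  expand : ∀ x y → (x + 1) * (x * y) + (y + 1) ≡ (x + 1) * y + (x * (x * y) + 1)
  expand = solve-∀

coprime-pred : ∀ m → Coprime m (suc m)
coprime-pred m {d} (d∣m , d∣1+m) = ∣1⇒≡1 (∣m+n∣m⇒∣n (subst (d ∣_) (+-comm 1 m) d∣1+m) d∣m)

-- With n odd and a ^ n ≡ 1, a power a ^ e ≡ −1 would give −1 ≡ (a ^ e) ^ n ≡ (a ^ n) ^ e ≡ 1 (mod q).
¬primitiveRoot-of-odd-order : ∀ {a q} k → 3 ≤ q → a ^ suc (k * 2) ≡1[mod q ] → ¬ IsPrimitiveRoot a q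
¬primitiveRoot-of-odd-order {a} {suc m} k 3≤q a^n≡1 (_ , generates)
  with e , a^e≡m ← generates m (coprime-pred m) = <⇒≱ 3≤q (∣⇒≤ q∣2)
  where
  n = suc (k * 2)
  q∣a^e+1 : suc m ∣ a ^ e + 1
  q∣a^e+1 = ∣+-resp-≡[mod] a^e≡m (subst (suc m ∣_) (+-comm 1 m) ∣-refl)
  a^en≡1 : (a ^ e) ^ n ≡1[mod suc m ]
  a^en≡1 = subst (_≡1[mod suc m ]) (trans (^-*-assoc a n e) (trans (cong (a ^_) (*-comm n e)) (sym (^-*-assoc a e n))))
                 (≡1[mod]-^ a^n≡1 e)
  c = proj₁ a^en≡1
  q∣2+cq : suc m ∣ (1 + c * suc m) + 1
  q∣2+cq = subst (λ t → suc m ∣ t + 1) (proj₂ a^en≡1) (∣x+1⇒∣x^odd+1 q∣a^e+1 k)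
  q∣2 : suc m ∣ 2
  q∣2 = ∣m+n∣m⇒∣n (subst (suc m ∣_) (trans (+-comm (1 + c * suc m) 1) (+-comm 2 (c * suc m))) q∣2+cq) (n∣m*n c)

coprime-%⇒coprime : ∀ m n .{{_ : NonZero n}} → Coprime (m % n) n → Coprime m n
coprime-%⇒coprime m n m%n⊥n (d∣m , d∣n) = m%n⊥n (%-presˡ-∣ d∣m d∣n , d∣n)

coprime-4⇒%4≡1∨3 : ∀ a → Coprime a 4 → a % 4 ≡ 1 ⊎ a % 4 ≡ 3
coprime-4⇒%4≡1∨3 a a⊥4 = oddResidue (a % 4) (m%n<n a 4) 2∤a%4
  where
  2∤a%4 : ¬ 2 ∣ a % 4
  2∤a%4 2∣a%4 with () ← a⊥4 (∣n∣m%n⇒∣m (divides 2 refl) 2∣a%4 , divides 2 refl)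
  oddResidue : ∀ r → r < 4 → ¬ 2 ∣ r → r ≡ 1 ⊎ r ≡ 3
  oddResidue 0 _ 2∤0 = ⊥-elim (2∤0 (2 ∣0))
  oddResidue 1 _ _   = inj₁ refl
  oddResidue 2 _ 2∤2 = ⊥-elim (2∤2 ∣-refl)
  oddResidue 3 _ _   = inj₂ refl
  oddResidue (suc (suc (suc (suc _)))) (s≤s (s≤s (s≤s (s≤s ())))) _

primitiveRoot-mod-4 : ∀ g → g % 4 ≡ 3 → IsPrimitiveRoot g 4
primitiveRoot-mod-4 g g%4≡3 = coprime-%⇒coprime g 4 (subst (λ r → Coprime r 4) (sym g%4≡3) (coprime-pred 3)) , generates
  where
  generates : ∀ a → Coprime a 4 → ∃ λ k → g ^ k ≡ a [mod 4 ]
  generates a a⊥4 with coprime-4⇒%4≡1∨3 a a⊥4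
  ... | inj₁ a%4≡1 = 0 , %≡%⇒≡[mod] 1 a 4 (sym a%4≡1)
  ... | inj₂ a%4≡3 = 1 , %≡%⇒≡[mod] (g * 1) a 4 (trans (cong (_% 4) (*-identityʳ g)) (trans g%4≡3 (sym a%4≡3)))

*-%4≡3 : ∀ m n → m * n % 4 ≡ 3 → m % 4 ≡ 3 ⊎ n % 4 ≡ 3
*-%4≡3 m n mn%4≡3 = table (m % 4) (n % 4) (m%n<n m 4) (m%n<n n 4) (trans (sym (%-distribˡ-* m n 4)) mn%4≡3)
  where
  table : ∀ r s → r < 4 → s < 4 → r * s % 4 ≡ 3 → r ≡ 3 ⊎ s ≡ 3
  table 3 _ _ _ _ = inj₁ refl
  table _ 3 _ _ _ = inj₂ refl
  table 0 0 _ _ ()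
  table 0 1 _ _ ()
  table 0 2 _ _ ()
  table 1 0 _ _ ()
  table 1 1 _ _ ()
  table 1 2 _ _ ()
  table 2 0 _ _ ()
  table 2 1 _ _ ()
  table 2 2 _ _ ()
  table (suc (suc (suc (suc _)))) _ (s≤s (s≤s (s≤s (s≤s ())))) _ _
  table _ (suc (suc (suc (suc _)))) _ (s≤s (s≤s (s≤s (s≤s ())))) _

product-%4≡3⇒any : ∀ xs → product xs % 4 ≡ 3 → Any (λ x → x % 4 ≡ 3) xs
product-%4≡3⇒any (x ∷ xs) p%4≡3 with *-%4≡3 x (product xs) p%4≡3
... | inj₁ x%4≡3  = here x%4≡3
... | inj₂ xs%4≡3 = there (product-%4≡3⇒any xs xs%4≡3)

%4≡3⇒∃prime∣-%4≡3 : ∀ n → n % 4 ≡ 3 → ∃ λ q → Prime q × q ∣ n × q % 4 ≡ 3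
%4≡3⇒∃prime∣-%4≡3 n@(suc _) n%4≡3 =
  primeFactor (find (product-%4≡3⇒any (factors f) (subst (λ m → m % 4 ≡ 3) (isFactorisation f) n%4≡3)))
  where
  f = factorise n
  primeFactor : ∃ (λ q → q ∈ factors f × q % 4 ≡ 3) → ∃ λ q → Prime q × q ∣ n × q % 4 ≡ 3
  primeFactor (q , q∈fs , q%4≡3) =
    q , All.lookup (factorsPrime f) q∈fs , subst (q ∣_) (sym (isFactorisation f)) (∈⇒∣product q∈fs) , q%4≡3

2^n≡1+[3+r*4] : ∀ {n} → 2 ≤ n → ∃ λ r → 2 ^ n ≡ 1 + (3 + r * 4)
2^n≡1+[3+r*4] {suc (suc m)} (s≤s (s≤s _)) with 2 ^ m | m^n>0 2 m
... | suc t | _ = t , expand t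
  where
  expand : ∀ t → 2 * (2 * suc t) ≡ 1 + (3 + t * 4)
  expand = solve-∀

theorem6p3 : (N : ℕ) → ∃₂ λ p q →
    N < p + q × Prime p × Prime q × ¬ IsPrimitiveRoot p q × IsPrimitiveRoot q (p ^ 2)
theorem6p3 N
  with r , 2^n≡1+M ← 2^n≡1+[3+r*4] (s≤s (≤-trans (1≤n! N) (m≤m*n (N !) 2)))
  with q , q-prime , divides c M≡cq , q%4≡3 ← %4≡3⇒∃prime∣-%4≡3 (3 + r * 4) ([m+kn]%n≡m%n 3 r 4)
  = 2 , q , N<2+q , prime[2] , q-prime , ¬primitiveRoot-of-odd-order (N !) 3≤q 2^n≡1 , primitiveRoot-mod-4 q q%4≡3
  where
  2^n≡1 : 2 ^ suc (N ! * 2) ≡1[mod q ]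
  2^n≡1 = c , trans 2^n≡1+M (cong suc M≡cq)
  3≤q : 3 ≤ q
  3≤q = subst (_≤ q) q%4≡3 (m%n≤m q 4)
  q∤2 : ¬ q ∣ 2
  q∤2 q∣2 = <⇒≱ 3≤q (∣⇒≤ q∣2)
  q≰N : ¬ q ≤ N
  q≰N q≤N = ¬prime[1] (subst Prime (∣1⇒≡1 q∣1) q-prime)
    where
    q∣1 : q ∣ 1
    q∣1 = ≡1[mod]-*ˡ⇒∣ 1 (^-factorial-≡1[mod] q-prime q∤2 q≤N (m∣m*n 2)) 2^n≡1
  N<2+q : N < 2 + q
  N<2+q = ≤-trans (≰⇒> q≰N) (m≤n+m q 2)
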